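{- Let $G$ be a $3$-free digraph on $n$ vertices. Then $S \leq \frac{3n}{2}T$, where $T=\tilde{P}_3(G)$ and $S$ is the number of $4$-tuples $(a,b,c,d)$ of distinct vertices such that $G|\{a,b,c,d\}$ is a directed cycle of length four.
   Context: Digraphs are finite and simple (no loops, no multiple edges). A digraph is $3$-free if it has no directed cycle of length at most $3$. $G|X$ denotes the subdigraph induced on $X$. $\tilde{P}_3(G)$ is the number of induced $3$-vertex directed paths, i.e. ordered triples $(u,w,v)$ of distinct vertices with $uw,wv\in E(G)$ and neither $uv$ nor $vu$ in $E(G)$. (Equivalently, $S$ is $24$ times the number of directed $4$-cycles in $G$.) -}

module Defs where

open import Data.Nat using (ℕ; _+_)
open import Data.Fin using (Fin)
open import Data.Fin.Properties using (_≟_)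
open import Data.Bool using (Bool; true; false; _∧_; _∨_; not; if_then_else_)
open import Data.List using (List; map; allFin)
open import Data.Nat.ListAction using (sum)
open import Data.Empty using (⊥)
open import Data.Product using (_×_)
open import Relation.Binary.PropositionalEquality using (_≡_)
open import Relation.Nullary.Decidable using (⌊_⌋)

-- Digons uv, vu are allowed by "simple" but excluded by 3-freeness.
record Digraph (n : ℕ) : Set where
  field
    E       : Fin n → Fin n → Bool
    noLoops : ∀ v → E v v ≡ false
open Digraph public

-- 3-free: no directed cycle of length at most 3 (length 1 is impossible
-- since there are no loops; lengths 2 and 3 are excluded here).
Is3Free : ∀ {n} → Digraph n → Set
Is3Free {n} G =
  (∀ (u v : Fin n) → E G u v ≡ true → E G v u ≡ true → ⊥) ×
  (∀ (u v w : Fin n) → E G u v ≡ true → E G v w ≡ true → E G w u ≡ true → ⊥)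

Σv : ∀ {n} → (Fin n → ℕ) → ℕ
Σv {n} f = sum (map f (allFin n))

ind : Bool → ℕ
ind b = if b then 1 else 0

eqb : ∀ {n} → Fin n → Fin n → Bool
eqb x y = ⌊ x ≟ y ⌋

adj : ∀ {n} → Digraph n → Fin n → Fin n → Bool
adj G x y = E G x y ∨ E G y x

isInducedP3 : ∀ {n} → Digraph n → Fin n → Fin n → Fin n → Bool
isInducedP3 G u w v =
  not (eqb u w) ∧ not (eqb w v) ∧ not (eqb u v) ∧
  E G u w ∧ E G w v ∧ not (adj G u v)

P3~ : ∀ {n} → Digraph n → ℕ
P3~ G = Σv λ u → Σv λ w → Σv λ v → ind (isInducedP3 G u w v)

cycleOn : ∀ {n} → Digraph n → Fin n → Fin n → Fin n → Fin n → Bool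
cycleOn G x₁ x₂ x₃ x₄ =
  E G x₁ x₂ ∧ E G x₂ x₃ ∧ E G x₃ x₄ ∧ E G x₄ x₁ ∧
  not (E G x₂ x₁) ∧ not (E G x₃ x₂) ∧ not (E G x₄ x₃) ∧ not (E G x₁ x₄) ∧
  not (adj G x₁ x₃) ∧ not (adj G x₂ x₄)

distinct4 : ∀ {n} → Fin n → Fin n → Fin n → Fin n → Bool
distinct4 a b c d =
  not (eqb a b) ∧ not (eqb a c) ∧ not (eqb a d) ∧
  not (eqb b c) ∧ not (eqb b d) ∧ not (eqb c d)

-- The six cyclic orderings of four labelled points
-- (cycles through a, up to rotation) are listed.
isC4 : ∀ {n} → Digraph n → Fin n → Fin n → Fin n → Fin n → Bool
isC4 G a b c d =
  distinct4 a b c d ∧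
  (cycleOn G a b c d ∨ cycleOn G a b d c ∨ cycleOn G a c b d ∨
   cycleOn G a c d b ∨ cycleOn G a d b c ∨ cycleOn G a d c b)

S4 : ∀ {n} → Digraph n → ℕ
S4 G = Σv λ a → Σv λ b → Σv λ c → Σv λ d → ind (isC4 G a b c d)

module Submission where

-- Call (u,w,v,x) a closed 4-walk if u→w→v→x→u, let C be the number of
-- closed 4-walks, and let π(s,t) (paths₂ below) be the number of directed
-- 2-paths s→y→t.  Sums are taken over lists, and over the vertex set Fin n.
--  (1) An induced 4-cycle on {a,b,c,d} runs through one of the six cyclic
--      orderings of a,b,c,d; since sums over 4-tuples are invariant under
--      permuting coordinates, S ≤ 6C.
--  (2) In a 3-free digraph the diagonals of a closed 4-walk are
--      non-adjacent, so a closed 4-walk is exactly an induced path u→w→v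
--      closed up by a 2-path v→x→u.  Hence C = Σ_{P̃₃} π(v,u) and
--      D := Σ_{closed walks} π(v,u) = Σ_{P̃₃} π(v,u)².
--  (3) For a closed 4-walk the middles of the 2-paths v→u, x→w, u→v, w→x
--      are pairwise distinct vertices (a common middle closes a cycle of
--      length ≤ 3); with the rotation symmetry of closed walks, 4D ≤ nC.
--  (4) Summing 8nπ ≤ 16π² + n² (AM-GM) over P̃₃ gives 8nC ≤ 16D + n²T.
-- From (3) and (4), 8nC ≤ 4nC + n²T, so 4C ≤ nT and 2S ≤ 12C ≤ 3nT.

open import Defs
open import Data.Nat using (ℕ; zero; suc; _+_; _*_; _≤_; z≤n)
open import Data.Nat.Properties
  using (≤-refl; ≤-trans; ≤-reflexive; ≤-total; +-mono-≤; +-monoˡ-≤; *-monoʳ-≤;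
         +-cancelˡ-≤; *-cancelˡ-≤; *-distribˡ-+; *-distribʳ-+; *-zeroʳ;
         *-comm; *-assoc; +-comm; +-identityʳ; m≤m+n; m≤n+m;
         m≤n⇒∃[o]m+o≡n; module ≤-Reasoning)
open import Data.Nat.ListAction using (sum)
open import Data.Nat.Tactic.RingSolver using (solve-∀)
open import Data.Bool using (Bool; true; false; _∧_; _∨_; not)
open import Data.Bool.Properties using (∧-comm; ∧-zeroʳ)
open import Data.Fin using (Fin)
open import Data.Fin.Properties using (_≟_)
open import Data.List using (List; []; _∷_; map; allFin; length)
open import Data.List.Properties using (length-tabulate)
open import Data.Empty using (⊥; ⊥-elim)
open import Data.Product using (_×_; _,_; proj₁; proj₂)
open import Data.Sum using (inj₁; inj₂)
open import Relation.Binary.PropositionalEquality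
  using (_≡_; refl; sym; trans; cong; cong₂; subst₂; module ≡-Reasoning)
open import Relation.Nullary using (yes; no)

∧-trueˡ : ∀ {a b} → a ∧ b ≡ true → a ≡ true
∧-trueˡ {true} _ = refl

∧-trueʳ : ∀ {a b} → a ∧ b ≡ true → b ≡ true
∧-trueʳ {true} h = h

∧-absorbˡ : ∀ {a b} → (b ≡ true → a ≡ true) → a ∧ b ≡ b
∧-absorbˡ {a} {false} _ = ∧-zeroʳ a
∧-absorbˡ {b = true} h rewrite h refl = refl

-- The same inside a three-edge pattern: used to drop the non-adjacency
-- condition of an induced path once the path is closed to a 4-walk.
∧-absorb-closing : ∀ a b {q} r → (a ∧ (b ∧ r) ≡ true → q ≡ true) →
  (a ∧ (b ∧ q)) ∧ r ≡ a ∧ (b ∧ r)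
∧-absorb-closing false b r _ = refl
∧-absorb-closing true false r _ = refl
∧-absorb-closing true true r h = ∧-absorbˡ h

∧-swapˡ : ∀ a b c → a ∧ (b ∧ c) ≡ b ∧ (a ∧ c)
∧-swapˡ false false c = refl
∧-swapˡ false true c = refl
∧-swapˡ true b c = refl

∧-rotate : ∀ a b c d → b ∧ (c ∧ (d ∧ a)) ≡ a ∧ (b ∧ (c ∧ d))
∧-rotate a b c d = begin
  b ∧ (c ∧ (d ∧ a)) ≡⟨ cong (λ z → b ∧ (c ∧ z)) (∧-comm d a) ⟩
  b ∧ (c ∧ (a ∧ d)) ≡⟨ cong (b ∧_) (∧-swapˡ c a d) ⟩
  b ∧ (a ∧ (c ∧ d)) ≡⟨ ∧-swapˡ b a (c ∧ d) ⟩
  a ∧ (b ∧ (c ∧ d)) ∎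
  where open ≡-Reasoning

ind≤1 : ∀ b → ind b ≤ 1
ind≤1 false = z≤n
ind≤1 true = ≤-refl

ind-∧ : ∀ a b → ind (a ∧ b) ≡ ind a * ind b
ind-∧ false b = refl
ind-∧ true b = sym (+-identityʳ (ind b))

ind-∧≤ˡ : ∀ a b → ind (a ∧ b) ≤ ind a
ind-∧≤ˡ false b = z≤n
ind-∧≤ˡ true b = ind≤1 b

ind-∧≤ʳ : ∀ a b → ind (a ∧ b) ≤ ind b
ind-∧≤ʳ false b = z≤n
ind-∧≤ʳ true b = ≤-refl

ind-∧-monoʳ : ∀ a {b c} → ind b ≤ ind c → ind (a ∧ b) ≤ ind (a ∧ c)
ind-∧-monoʳ false _ = z≤n
ind-∧-monoʳ true h = h

ind-∨ : ∀ {a b m k} → ind a ≤ m → ind b ≤ k → ind (a ∨ b) ≤ m + k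
ind-∨ {false} {m = m} {k} _ hb = ≤-trans hb (m≤n+m k m)
ind-∨ {true} {m = m} {k} ha _ = ≤-trans ha (m≤m+n m k)

ind-guard : ∀ b {m k} → (b ≡ true → m ≤ k) → ind b * m ≤ ind b * k
ind-guard false _ = z≤n
ind-guard true h = +-monoˡ-≤ 0 (h refl)

Exclusive : Bool → Bool → Set
Exclusive a b = a ≡ true → b ≡ true → ⊥

at-most-one : ∀ {a b c d} →
  Exclusive a b → Exclusive a c → Exclusive a d →
  Exclusive b c → Exclusive b d → Exclusive c d →
  ind a + ind b + ind c + ind d ≤ 1
at-most-one {false} {false} {false} {d} _ _ _ _ _ _ = ind≤1 d
at-most-one {false} {false} {true} {false} _ _ _ _ _ _ = ≤-refl
at-most-one {false} {false} {true} {true} _ _ _ _ _ cd = ⊥-elim (cd refl refl)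
at-most-one {false} {true} {false} {false} _ _ _ _ _ _ = ≤-refl
at-most-one {false} {true} {false} {true} _ _ _ _ bd _ = ⊥-elim (bd refl refl)
at-most-one {false} {true} {true} _ _ _ bc _ _ = ⊥-elim (bc refl refl)
at-most-one {true} {false} {false} {false} _ _ _ _ _ _ = ≤-refl
at-most-one {true} {false} {false} {true} _ _ ad _ _ _ = ⊥-elim (ad refl refl)
at-most-one {true} {false} {true} _ ac _ _ _ _ = ⊥-elim (ac refl refl)
at-most-one {true} {true} ab _ _ _ _ _ = ⊥-elim (ab refl refl)

-- AM-GM over ℕ, i.e. (a - b)² ≥ 0: first for a ≤ b (write b = a + k),
-- then by symmetry.

amgm-ordered : ∀ {a b} → a ≤ b → 2 * a * b ≤ a * a + b * b
amgm-ordered {a} a≤b with k , refl ← m≤n⇒∃[o]m+o≡n a≤b =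
  ≤-trans (m≤m+n (2 * a * (a + k)) (k * k)) (≤-reflexive (square a k))
  where
  square : ∀ a k → 2 * a * (a + k) + k * k ≡ a * a + (a + k) * (a + k)
  square = solve-∀

amgm : ∀ a b → 2 * a * b ≤ a * a + b * b
amgm a b with ≤-total a b
... | inj₁ a≤b = amgm-ordered a≤b
... | inj₂ b≤a = subst₂ _≤_ (symmetric b a) (+-comm (b * b) (a * a)) (amgm-ordered b≤a)
  where
  symmetric : ∀ b a → 2 * b * a ≡ 2 * a * b
  symmetric = solve-∀

Σl : ∀ {A : Set} → List A → (A → ℕ) → ℕ
Σl xs f = sum (map f xs)

private
  variable
    A B : Set


Σl-cong : ∀ (xs : List A) {f g : A → ℕ} → (∀ x → f x ≡ g x) → Σl xs f ≡ Σl xs g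
Σl-cong [] _ = refl
Σl-cong (x ∷ xs) h = cong₂ _+_ (h x) (Σl-cong xs h)

Σl-mono : ∀ (xs : List A) {f g : A → ℕ} → (∀ x → f x ≤ g x) → Σl xs f ≤ Σl xs g
Σl-mono [] _ = z≤n
Σl-mono (x ∷ xs) h = +-mono-≤ (h x) (Σl-mono xs h)

Σl-+ : ∀ (xs : List A) (f g : A → ℕ) →
  Σl xs (λ x → f x + g x) ≡ Σl xs f + Σl xs g
Σl-+ [] f g = refl
Σl-+ (x ∷ xs) f g rewrite Σl-+ xs f g = interchange (f x) (g x) (Σl xs f) (Σl xs g)
  where
  interchange : ∀ a b c d → (a + b) + (c + d) ≡ (a + c) + (b + d)
  interchange = solve-∀

Σl-*ˡ : ∀ (xs : List A) (c : ℕ) (f : A → ℕ) → Σl xs (λ x → c * f x) ≡ c * Σl xs f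
Σl-*ˡ [] c f = sym (*-zeroʳ c)
Σl-*ˡ (x ∷ xs) c f rewrite Σl-*ˡ xs c f = sym (*-distribˡ-+ c (f x) (Σl xs f))

Σl-*ʳ : ∀ (xs : List A) (c : ℕ) (f : A → ℕ) → Σl xs (λ x → f x * c) ≡ Σl xs f * c
Σl-*ʳ [] c f = refl
Σl-*ʳ (x ∷ xs) c f rewrite Σl-*ʳ xs c f = sym (*-distribʳ-+ c (f x) (Σl xs f))

Σl-zero : ∀ (xs : List A) → Σl xs (λ _ → 0) ≡ 0
Σl-zero [] = refl
Σl-zero (x ∷ xs) = Σl-zero xs

Σl-one : ∀ (xs : List A) → Σl xs (λ _ → 1) ≡ length xs
Σl-one [] = refl
Σl-one (x ∷ xs) = cong suc (Σl-one xs)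

Σl-swap : ∀ (xs : List A) (ys : List B) (k : A → B → ℕ) →
  Σl xs (λ x → Σl ys (k x)) ≡ Σl ys (λ y → Σl xs (λ x → k x y))
Σl-swap [] ys k = sym (Σl-zero ys)
Σl-swap (x ∷ xs) ys k rewrite Σl-swap xs ys k =
  sym (Σl-+ ys (k x) (λ y → Σl xs (λ x → k x y)))

module MultiSum {A : Set} (xs : List A) where

  Σ2 : (A → A → ℕ) → ℕ
  Σ2 h = Σl xs λ a → Σl xs (h a)

  Σ3 : (A → A → A → ℕ) → ℕ
  Σ3 h = Σl xs λ a → Σ2 (h a)

  Σ4 : (A → A → A → A → ℕ) → ℕ
  Σ4 h = Σl xs λ a → Σ3 (h a)

  Σ2-cong : ∀ {f g} → (∀ a b → f a b ≡ g a b) → Σ2 f ≡ Σ2 g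
  Σ2-cong h = Σl-cong xs λ a → Σl-cong xs (h a)

  Σ3-cong : ∀ {f g} → (∀ a b c → f a b c ≡ g a b c) → Σ3 f ≡ Σ3 g
  Σ3-cong h = Σl-cong xs λ a → Σ2-cong (h a)

  Σ4-cong : ∀ {f g} → (∀ a b c d → f a b c d ≡ g a b c d) → Σ4 f ≡ Σ4 g
  Σ4-cong h = Σl-cong xs λ a → Σ3-cong (h a)

  Σ2-mono : ∀ {f g} → (∀ a b → f a b ≤ g a b) → Σ2 f ≤ Σ2 g
  Σ2-mono h = Σl-mono xs λ a → Σl-mono xs (h a)

  Σ3-mono : ∀ {f g} → (∀ a b c → f a b c ≤ g a b c) → Σ3 f ≤ Σ3 g
  Σ3-mono h = Σl-mono xs λ a → Σ2-mono (h a)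

  Σ4-mono : ∀ {f g} → (∀ a b c d → f a b c d ≤ g a b c d) → Σ4 f ≤ Σ4 g
  Σ4-mono h = Σl-mono xs λ a → Σ3-mono (h a)

  Σ2-+ : ∀ f g → Σ2 (λ a b → f a b + g a b) ≡ Σ2 f + Σ2 g
  Σ2-+ f g = trans (Σl-cong xs λ a → Σl-+ xs (f a) (g a)) (Σl-+ xs _ _)

  Σ3-+ : ∀ f g → Σ3 (λ a b c → f a b c + g a b c) ≡ Σ3 f + Σ3 g
  Σ3-+ f g = trans (Σl-cong xs λ a → Σ2-+ (f a) (g a)) (Σl-+ xs _ _)

  Σ4-+ : ∀ f g → Σ4 (λ a b c d → f a b c d + g a b c d) ≡ Σ4 f + Σ4 g
  Σ4-+ f g = trans (Σl-cong xs λ a → Σ3-+ (f a) (g a)) (Σl-+ xs _ _)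

  Σ2-* : ∀ k f → Σ2 (λ a b → k * f a b) ≡ k * Σ2 f
  Σ2-* k f = trans (Σl-cong xs λ a → Σl-*ˡ xs k (f a)) (Σl-*ˡ xs k _)

  Σ3-* : ∀ k f → Σ3 (λ a b c → k * f a b c) ≡ k * Σ3 f
  Σ3-* k f = trans (Σl-cong xs λ a → Σ2-* k (f a)) (Σl-*ˡ xs k _)

  Σ4-* : ∀ k f → Σ4 (λ a b c d → k * f a b c d) ≡ k * Σ4 f
  Σ4-* k f = trans (Σl-cong xs λ a → Σ3-* k (f a)) (Σl-*ˡ xs k _)

  Σ4-swap₁₂ : ∀ h → Σ4 (λ a b c d → h b a c d) ≡ Σ4 h
  Σ4-swap₁₂ h = Σl-swap xs xs (λ a b → Σ2 (h b a))

  Σ4-swap₂₃ : ∀ h → Σ4 (λ a b c d → h a c b d) ≡ Σ4 h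
  Σ4-swap₂₃ h = Σl-cong xs λ a → Σl-swap xs xs (λ b c → Σl xs (h a c b))

  Σ4-swap₃₄ : ∀ h → Σ4 (λ a b c d → h a b d c) ≡ Σ4 h
  Σ4-swap₃₄ h = Σl-cong xs λ a → Σl-cong xs λ b → Σl-swap xs xs (λ c d → h a b d c)

  Σ4-acdb : ∀ h → Σ4 (λ a b c d → h a c d b) ≡ Σ4 h
  Σ4-acdb h = trans (Σ4-swap₂₃ (λ a b c d → h a b d c)) (Σ4-swap₃₄ h)

  Σ4-adbc : ∀ h → Σ4 (λ a b c d → h a d b c) ≡ Σ4 h
  Σ4-adbc h = trans (Σ4-swap₃₄ (λ a b c d → h a c b d)) (Σ4-swap₂₃ h)

  Σ4-adcb : ∀ h → Σ4 (λ a b c d → h a d c b) ≡ Σ4 h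
  Σ4-adcb h = trans (Σ4-swap₂₃ (λ a b c d → h a d b c)) (Σ4-adbc h)

  Σ4-rotate : ∀ h → Σ4 (λ a b c d → h b c d a) ≡ Σ4 h
  Σ4-rotate h = trans (Σ4-swap₁₂ (λ a b c d → h a c d b)) (Σ4-acdb h)

vertex-count : ∀ n → Σv {n} (λ _ → 1) ≡ n
vertex-count n = trans (Σl-one (allFin n)) (length-tabulate (λ x → x))

module ClosedWalks {n : ℕ} (G : Digraph n) where
  open MultiSum (allFin n)

  closedWalk : Fin n → Fin n → Fin n → Fin n → Bool
  closedWalk u w v x = E G u w ∧ (E G w v ∧ (E G v x ∧ E G x u))

  W : Fin n → Fin n → Fin n → Fin n → ℕ
  W u w v x = ind (closedWalk u w v x)

  C : ℕ
  C = Σ4 W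

  walk-edges : ∀ {u w v x} → closedWalk u w v x ≡ true →
    E G u w ≡ true × E G w v ≡ true × E G v x ≡ true × E G x u ≡ true
  walk-edges {u} {w} {v} {x} cw with E G u w | E G w v | E G v x | E G x u
  ... | true | true | true | true = refl , refl , refl , refl

  W-rotate : ∀ u w v x → W w v x u ≡ W u w v x
  W-rotate u w v x = cong ind (∧-rotate (E G u w) (E G w v) (E G v x) (E G x u))

  cycleOn≤W : ∀ a b c d → ind (cycleOn G a b c d) ≤ W a b c d
  cycleOn≤W a b c d =
    ind-∧-monoʳ (E G a b) (ind-∧-monoʳ (E G b c) (ind-∧-monoʳ (E G c d)
      (ind-∧≤ˡ (E G d a) _)))

  orderings : Fin n → Fin n → Fin n → Fin n → ℕ
  orderings a b c d =
    W a b c d + (W a b d c + (W a c b d + (W a c d b + (W a d b c + W a d c b))))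

  isC4≤orderings : ∀ a b c d → ind (isC4 G a b c d) ≤ orderings a b c d
  isC4≤orderings a b c d = ≤-trans (ind-∧≤ʳ (distinct4 a b c d) _)
    (ind-∨ (cycleOn≤W a b c d) (ind-∨ (cycleOn≤W a b d c) (ind-∨ (cycleOn≤W a c b d)
      (ind-∨ (cycleOn≤W a c d b) (ind-∨ (cycleOn≤W a d b c) (cycleOn≤W a d c b))))))

  -- Each ordering is a permutation of the coordinates, so contributes C.
  orderings-sum : Σ4 orderings ≡ 6 * C
  orderings-sum = begin
    Σ4 orderings
      ≡⟨ trans (Σ4-+ W _) (cong (C +_)
         (trans (Σ4-+ _ _) (cong₂ _+_ (Σ4-swap₃₄ W)
         (trans (Σ4-+ _ _) (cong₂ _+_ (Σ4-swap₂₃ W)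
         (trans (Σ4-+ _ _) (cong₂ _+_ (Σ4-acdb W)
         (trans (Σ4-+ _ _) (cong₂ _+_ (Σ4-adbc W) (Σ4-adcb W)))))))))) ⟩
    C + (C + (C + (C + (C + C))))
      ≡⟨ cong (λ m → C + (C + (C + (C + (C + m))))) (sym (+-identityʳ C)) ⟩
    6 * C ∎
    where open ≡-Reasoning

  S4≤6C : S4 G ≤ 6 * C
  S4≤6C = ≤-trans (Σ4-mono isC4≤orderings) (≤-reflexive orderings-sum)

  paths₂ : Fin n → Fin n → ℕ
  paths₂ s t = Σv λ y → ind (E G s y ∧ E G y t)

  weighted : (Fin n → Fin n → Fin n → Fin n → ℕ) → ℕ
  weighted g = Σ4 λ u w v x → W u w v x * g u w v x

  D : ℕ
  D = weighted λ u w v x → paths₂ v u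

  weighted-rotate : ∀ g → weighted (λ u w v x → g w v x u) ≡ weighted g
  weighted-rotate g =
    trans (Σ4-cong λ u w v x → cong (_* g w v x u) (sym (W-rotate u w v x)))
          (Σ4-rotate λ u w v x → W u w v x * g u w v x)

  weighted-+ : ∀ g h → weighted (λ u w v x → g u w v x + h u w v x) ≡ weighted g + weighted h
  weighted-+ g h =
    trans (Σ4-cong λ u w v x → *-distribˡ-+ (W u w v x) (g u w v x) (h u w v x))
          (Σ4-+ _ _)

-- AM-GM weighted by p, in the form summed over induced paths.
weighted-amgm : ∀ p t n → 8 * n * (p * t) ≤ 16 * (p * t * t) + n * n * p
weighted-amgm p t n = subst₂ _≤_ (lhs p t n) (rhs p t n) (*-monoʳ-≤ p (amgm (4 * t) n))
  where
  lhs : ∀ p t n → p * (2 * (4 * t) * n) ≡ 8 * n * (p * t)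
  lhs = solve-∀
  rhs : ∀ p t n → p * (4 * t * (4 * t) + n * n) ≡ 16 * (p * t * t) + n * n * p
  rhs = solve-∀

module ThreeFree {n : ℕ} (G : Digraph n) (free : Is3Free G) where
  open MultiSum (allFin n)
  open ClosedWalks G

  no-digon : ∀ u v → E G u v ≡ true → E G v u ≡ true → ⊥
  no-digon = proj₁ free

  no-triangle : ∀ u v w → E G u v ≡ true → E G v w ≡ true → E G w u ≡ true → ⊥
  no-triangle = proj₂ free

  edge⇒distinct : ∀ {a b} → E G a b ≡ true → not (eqb a b) ≡ true
  edge⇒distinct {a} {b} e with a ≟ b
  ... | no _ = refl
  ... | yes refl with trans (sym (noLoops G a)) e
  ...   | ()

  path⇒distinct : ∀ {u w v} → E G u w ≡ true → E G w v ≡ true → not (eqb u v) ≡ true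
  path⇒distinct {u} {w} {v} e₁ e₂ with u ≟ v
  ... | no _ = refl
  ... | yes refl = ⊥-elim (no-digon u w e₁ e₂)

  -- Distinctness in the definition of P̃₃ is implied by the two edges.
  inducedP3-edges : ∀ u w v →
    isInducedP3 G u w v ≡ E G u w ∧ (E G w v ∧ not (adj G u v))
  inducedP3-edges u w v = begin
    not (eqb u w) ∧ (not (eqb w v) ∧ (not (eqb u v) ∧ path))
      ≡⟨ cong (λ z → not (eqb u w) ∧ (not (eqb w v) ∧ z))
              (∧-absorbˡ λ h → path⇒distinct (uw h) (wv h)) ⟩
    not (eqb u w) ∧ (not (eqb w v) ∧ path)
      ≡⟨ cong (not (eqb u w) ∧_) (∧-absorbˡ λ h → edge⇒distinct (wv h)) ⟩
    not (eqb u w) ∧ path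
      ≡⟨ ∧-absorbˡ (λ h → edge⇒distinct (uw h)) ⟩
    path ∎
    where
    open ≡-Reasoning
    path : Bool
    path = E G u w ∧ (E G w v ∧ not (adj G u v))
    uw : path ≡ true → E G u w ≡ true
    uw = ∧-trueˡ
    wv : path ≡ true → E G w v ≡ true
    wv h = ∧-trueˡ (∧-trueʳ {E G u w} h)

  nonadjacent : ∀ {a b} → (E G a b ≡ true → ⊥) → (E G b a ≡ true → ⊥) →
    not (adj G a b) ≡ true
  nonadjacent {a} {b} ¬ab ¬ba with E G a b | E G b a
  ... | false | false = refl
  ... | true | _ = ⊥-elim (¬ab refl)
  ... | false | true = ⊥-elim (¬ba refl)

  -- The diagonals of a closed 4-walk are non-adjacent: an edge u→v closes
  -- the triangle u→v→x→u, an edge v→u the triangle u→w→v→u.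
  diagonal-nonadjacent : ∀ u w v x → closedWalk u w v x ≡ true → not (adj G u v) ≡ true
  diagonal-nonadjacent u w v x cw with walk-edges {u} {w} {v} {x} cw
  ... | e₁ , e₂ , e₃ , e₄ = nonadjacent
    (λ uv → no-triangle u v x uv e₃ e₄) (λ vu → no-triangle u w v e₁ e₂ vu)

  closing : ∀ u w v x →
    ind (isInducedP3 G u w v) * ind (E G v x ∧ E G x u) ≡ W u w v x
  closing u w v x = begin
    ind (isInducedP3 G u w v) * ind back  ≡⟨ sym (ind-∧ (isInducedP3 G u w v) back) ⟩
    ind (isInducedP3 G u w v ∧ back)      ≡⟨ cong (λ b → ind (b ∧ back)) (inducedP3-edges u w v) ⟩
    ind ((E G u w ∧ (E G w v ∧ not (adj G u v))) ∧ back)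
      ≡⟨ cong ind (∧-absorb-closing (E G u w) (E G w v) back (diagonal-nonadjacent u w v x)) ⟩
    W u w v x ∎
    where
    open ≡-Reasoning
    back = E G v x ∧ E G x u

  closings : ∀ u w v → Σv (W u w v) ≡ ind (isInducedP3 G u w v) * paths₂ v u
  closings u w v = trans (Σl-cong (allFin n) λ x → sym (closing u w v x))
                         (Σl-*ˡ (allFin n) (ind (isInducedP3 G u w v))
                                (λ x → ind (E G v x ∧ E G x u)))

  C-over-paths : C ≡ Σ3 λ u w v → ind (isInducedP3 G u w v) * paths₂ v u
  C-over-paths = Σ3-cong closings

  D-over-paths : D ≡ Σ3 λ u w v → ind (isInducedP3 G u w v) * paths₂ v u * paths₂ v u
  D-over-paths = Σ3-cong λ u w v →
    trans (Σl-*ʳ (allFin n) (paths₂ v u) (W u w v)) (cong (_* paths₂ v u) (closings u w v))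

  amgm-bound : 8 * n * C ≤ 16 * D + n * n * P3~ G
  amgm-bound = begin
    8 * n * C                                   ≡⟨ cong (8 * n *_) C-over-paths ⟩
    8 * n * Σ3 (λ u w v → p u w v * t u v)      ≡⟨ Σ3-* (8 * n) _ ⟨
    Σ3 (λ u w v → 8 * n * (p u w v * t u v))
      ≤⟨ Σ3-mono (λ u w v → weighted-amgm (p u w v) (t u v) n) ⟩
    Σ3 (λ u w v → 16 * (p u w v * t u v * t u v) + n * n * p u w v)
      ≡⟨ Σ3-+ _ _ ⟩
    Σ3 (λ u w v → 16 * (p u w v * t u v * t u v)) + Σ3 (λ u w v → n * n * p u w v)
      ≡⟨ cong₂ _+_ (Σ3-* 16 _) (Σ3-* (n * n) p) ⟩
    16 * Σ3 (λ u w v → p u w v * t u v * t u v) + n * n * P3~ G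
      ≡⟨ cong (λ m → 16 * m + n * n * P3~ G) D-over-paths ⟨
    16 * D + n * n * P3~ G ∎
    where
    open ≤-Reasoning
    p : Fin n → Fin n → Fin n → ℕ
    p u w v = ind (isInducedP3 G u w v)
    t : Fin n → Fin n → ℕ
    t u v = paths₂ v u

  -- For a closed walk u→w→v→x→u, a vertex y is the middle of at most one
  -- of the 2-paths v→y→u, x→y→w, u→y→v, w→y→x: any two of them would
  -- create a digon or a directed triangle.
  middles-exclusive : ∀ {u w v x} → closedWalk u w v x ≡ true → ∀ y →
    ind (E G v y ∧ E G y u) + ind (E G x y ∧ E G y w) +
    ind (E G u y ∧ E G y v) + ind (E G w y ∧ E G y x) ≤ 1
  middles-exclusive {u} {w} {v} {x} cw y with walk-edges {u} {w} {v} {x} cw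
  ... | uw , wv , vx , xu = at-most-one
    (λ A B → no-triangle y w v (∧-trueʳ B) wv (∧-trueˡ A))
    (λ A C → no-digon u y (∧-trueˡ C) (∧-trueʳ A))
    (λ A D → no-triangle u w y uw (∧-trueˡ D) (∧-trueʳ A))
    (λ B C → no-triangle y v x (∧-trueʳ C) vx (∧-trueˡ B))
    (λ B D → no-digon w y (∧-trueˡ D) (∧-trueʳ B))
    (λ C D → no-triangle y x u (∧-trueʳ D) xu (∧-trueˡ C))

  closing-paths≤n : ∀ u w v x → closedWalk u w v x ≡ true →
    paths₂ v u + paths₂ x w + paths₂ u v + paths₂ w x ≤ n
  closing-paths≤n u w v x cw = begin
    paths₂ v u + paths₂ x w + paths₂ u v + paths₂ w x
      ≡⟨ trans (Σl-+ V _ _) (cong (_+ paths₂ w x)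
         (trans (Σl-+ V _ _) (cong (_+ paths₂ u v) (Σl-+ V _ _)))) ⟨
    Σv (λ y → ind (E G v y ∧ E G y u) + ind (E G x y ∧ E G y w) +
              ind (E G u y ∧ E G y v) + ind (E G w y ∧ E G y x))
      ≤⟨ Σl-mono V (middles-exclusive cw) ⟩
    Σv {n} (λ _ → 1) ≡⟨ vertex-count n ⟩
    n ∎
    where
    open ≤-Reasoning
    V = allFin n

  -- Each rotation of the closed walk contributes D, and together the four
  -- rotated weights count pairwise distinct vertices.
  rotation-bound : 4 * D ≤ n * C
  rotation-bound = begin
    4 * D                       ≡⟨ four-times D ⟩
    D + D + D + D               ≡⟨ cong₂ _+_ (cong₂ _+_ (cong (D +_) r₁) r₂) r₃ ⟨
    weighted d₀ + weighted d₁ + weighted d₂ + weighted d₃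
      ≡⟨ trans (weighted-+ _ d₃) (cong (_+ weighted d₃)
         (trans (weighted-+ _ d₂) (cong (_+ weighted d₂) (weighted-+ d₀ d₁)))) ⟨
    weighted (λ u w v x → d₀ u w v x + d₁ u w v x + d₂ u w v x + d₃ u w v x)
      ≤⟨ Σ4-mono (λ u w v x → ind-guard (closedWalk u w v x) (closing-paths≤n u w v x)) ⟩
    Σ4 (λ u w v x → W u w v x * n) ≡⟨ Σ4-cong (λ u w v x → *-comm (W u w v x) n) ⟩
    Σ4 (λ u w v x → n * W u w v x) ≡⟨ Σ4-* n W ⟩
    n * C ∎
    where
    open ≤-Reasoning
    four-times : ∀ m → 4 * m ≡ m + m + m + m
    four-times = solve-∀
    d₀ d₁ d₂ d₃ : Fin n → Fin n → Fin n → Fin n → ℕ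
    d₀ u w v x = paths₂ v u
    d₁ u w v x = paths₂ x w
    d₂ u w v x = paths₂ u v
    d₃ u w v x = paths₂ w x
    r₁ : weighted d₁ ≡ D
    r₁ = weighted-rotate d₀
    r₂ : weighted d₂ ≡ D
    r₂ = trans (weighted-rotate d₁) r₁
    r₃ : weighted d₃ ≡ D
    r₃ = trans (weighted-rotate d₂) r₂

combine : ∀ n C D T → 8 * n * C ≤ 16 * D + n * n * T → 4 * D ≤ n * C →
  n * (4 * C) ≤ n * (n * T)
combine n C D T amgm-step rotation-step = +-cancelˡ-≤ (n * (4 * C)) _ _ (begin
  n * (4 * C) + n * (4 * C)   ≡⟨ double n C ⟩
  8 * n * C                   ≤⟨ amgm-step ⟩
  16 * D + n * n * T          ≡⟨ cong (_+ n * n * T) (*-assoc 4 4 D) ⟩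
  4 * (4 * D) + n * n * T     ≤⟨ +-monoˡ-≤ (n * n * T) (*-monoʳ-≤ 4 rotation-step) ⟩
  4 * (n * C) + n * n * T     ≡⟨ regroup n C T ⟩
  n * (4 * C) + n * (n * T)   ∎)
  where
  open ≤-Reasoning
  double : ∀ n C → n * (4 * C) + n * (4 * C) ≡ 8 * n * C
  double = solve-∀
  regroup : ∀ n C T → 4 * (n * C) + n * n * T ≡ n * (4 * C) + n * (n * T)
  regroup = solve-∀

lemma4p2 : ∀ (n : ℕ) (G : Digraph n) → Is3Free G →
    2 * S4 G ≤ 3 * n * P3~ G
lemma4p2 zero G free = z≤n
lemma4p2 n@(suc _) G free = begin
  2 * S4 G          ≤⟨ *-monoʳ-≤ 2 S4≤6C ⟩
  2 * (6 * C)       ≡⟨ trans (sym (*-assoc 2 6 C)) (*-assoc 3 4 C) ⟩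
  3 * (4 * C)       ≤⟨ *-monoʳ-≤ 3 4C≤nT ⟩
  3 * (n * P3~ G)   ≡⟨ *-assoc 3 n (P3~ G) ⟨
  3 * n * P3~ G     ∎
  where
  open ≤-Reasoning
  open ClosedWalks G
  open ThreeFree G free
  4C≤nT : 4 * C ≤ n * P3~ G
  4C≤nT = *-cancelˡ-≤ n (combine n C D (P3~ G) amgm-bound rotation-bound)
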